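{- For all integers $h\geq 0$ and $d\geq 1$, the tree $\mathcal{T}^h$ with size parameter $d$ satisfies: (1) its number of nodes is at most $\frac{3}{2}(h+1)(d+1)^{h+1}$; (2) $|L(\mathcal{T}^h)|=d^h$; (3) for every leaf $\ell\in L(\mathcal{T}^h)$ there exists an edge set $F_\ell\subseteq E(\mathcal{T}^h)$ with $|F_\ell|\leq h$ such that $\mathrm{dist}_{\mathcal{T}^h\setminus F_\ell}(rt(\mathcal{T}^h),\ell)$ is finite and $\mathrm{dist}_{\mathcal{T}^h\setminus F_\ell}(rt(\mathcal{T}^h),\ell)+2\leq \mathrm{dist}_{\mathcal{T}^h\setminus F_\ell}(rt(\mathcal{T}^h),\ell')$ for every $\ell'\in L(\mathcal{T}^h)\setminus\{\ell\}$.
   Context: The undirected unweighted rooted tree $\mathcal{T}^h$ with size parameter $d$ is defined recursively. $\mathcal{T}^0$ is a single node, its root, which is also its unique leaf. For $h\geq 1$, take $d$ disjoint copies $\mathcal{T}^{h-1}_0,\ldots,\mathcal{T}^{h-1}_{d-1}$ of $\mathcal{T}^{h-1}$, add a new path $v_0,\ldots,v_{d-1}$, set $rt(\mathcal{T}^h)=v_0$, and for each $j$ connect $v_j$ to $rt(\mathcal{T}^{h-1}_j)$ by a path with new internal nodes of length $(d-j)(\ell(h-1)+3)$, where $\ell(h-1)$ is the height of $\mathcal{T}^{h-1}$ (maximum distance from its root to a node). The leaf set $L(\mathcal{T}^h)$ is the union of the leaf sets of the copies $\mathcal{T}^{h-1}_j$. Distances to nodes disconnected from the root are infinite. -}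

module Defs where

open import Data.Nat using (ℕ; zero; suc; _+_; _*_; _∸_; _≤_; _<_; pred)
open import Data.Product using (Σ; ∃; _×_; _,_; proj₁; proj₂)
open import Data.Sum using (_⊎_)
open import Data.List using (List; []; _∷_; _++_; map; concat; upTo; applyUpTo)
open import Data.List.Membership.Propositional using (_∈_; _∉_)
open import Relation.Binary.PropositionalEquality using (_≡_)

Edge : Set
Edge = ℕ × ℕ

-- A finite undirected graph whose nodes are 0 , … , size - 1,
-- with a distinguished root and a distinguished list of leaves.
-- Each undirected edge {u,v} is listed once as (u , v) or (v , u).
record Tree : Set where
  constructor mkTree
  field
    size   : ℕ
    root   : ℕ
    leaves : List ℕ
    edges  : List Edge
open Tree public

Adj : List Edge → List Edge → ℕ → ℕ → Set
Adj E F u v = Σ Edge λ e → e ∈ E × e ∉ F × (e ≡ (u , v) ⊎ e ≡ (v , u))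

data Walk (E F : List Edge) : ℕ → ℕ → ℕ → Set where
  here : ∀ {u} → Walk E F u u 0
  step : ∀ {u v w n} → Adj E F u v → Walk E F v w n → Walk E F u w (suc n)

IsDist : List Edge → List Edge → ℕ → ℕ → ℕ → Set
IsDist E F u v k = Walk E F u v k × (∀ m → Walk E F u v m → k ≤ m)

IsHeight : Tree → ℕ → Set
IsHeight T k =
  (Σ ℕ λ x → x < size T × IsDist (edges T) [] (root T) x k) ×
  (∀ x → x < size T → Σ ℕ λ m → m ≤ k × IsDist (edges T) [] (root T) x m)

-- edges of a path from a to b with m ≥ 1 edges, whose m - 1 internal
-- nodes are the fresh nodes s , s + 1 , … , s + m - 2
pathEdges : ℕ → ℕ → ℕ → ℕ → List Edge
pathEdges a b zero          s = []
pathEdges a b (suc zero)    s = (a , b) ∷ []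
pathEdges a b (suc (suc m)) s = (a , s) ∷ pathEdges s b (suc m) (suc s)

shiftEdge : ℕ → Edge → Edge
shiftEdge o (u , v) = (o + u , o + v)

T0 : Tree
T0 = mkTree 1 0 (0 ∷ []) []

module Build (d : ℕ) (T : Tree) (k : ℕ) where
  -- k is the height ℓ(h-1) of T = T^{h-1}
  N' : ℕ
  N' = size T

  -- copy j of T occupies nodes j * N' , … , j * N' + N' - 1
  copyEdges : List Edge
  copyEdges = concat (applyUpTo (λ j → map (shiftEdge (j * N')) (edges T)) d)

  copyLeaves : List ℕ
  copyLeaves = concat (applyUpTo (λ j → map (j * N' +_) (leaves T)) d)

  v : ℕ → ℕ
  v j = d * N' + j

  spineEdges : List Edge
  spineEdges = applyUpTo (λ j → (v j , v (suc j))) (d ∸ 1)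

  -- for j , j+1 , … (fuel many): connect v_j to the root of copy j by a
  -- path of length (d - j)(k + 3); fresh internal nodes start at s.
  -- returns the edges and the next free node
  conns : ℕ → ℕ → ℕ → List Edge × ℕ
  conns j zero     s = [] , s
  conns j (suc f)  s =
    let m    = (d ∸ j) * (k + 3)
        rest = conns (suc j) f (s + pred m)
    in pathEdges (v j) (j * N' + root T) m s ++ proj₁ rest , proj₂ rest

  connResult : List Edge × ℕ
  connResult = conns 0 d (d * N' + d)

  tree : Tree
  tree = mkTree (proj₂ connResult) (v 0) copyLeaves
                (copyEdges ++ spineEdges ++ proj₁ connResult)

-- IsT d h T : T is (a presentation of) the tree T^h with size parameter d
data IsT (d : ℕ) : ℕ → Tree → Set where
  base : IsT d 0 T0
  step : ∀ {h T k} → IsT d h T → IsHeight T k → IsT d (suc h) (Build.tree d T k)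

-- A walk in E ∖ F from the root to x has length at least φ x whenever φ is a
-- potential that changes by at most one along every edge of E ∖ F and vanishes at
-- the root.  For a leaf in copy J of 𝒯^{h+1} we cut the edges inherited from
-- copy J and the spine edge v_J v_{J+1}.  The potential then measures the
-- distance along the spine and the connecting paths of copies j ≤ J, is the
-- inherited potential shifted by J + (d − J)(ℓ(h) + 3) inside copy J, and is the
-- constant (d + 1)(ℓ(h) + 3) on the part cut off.  Copy J' < J is entered
-- J − J' spine steps earlier but along a connecting path longer by
-- (J − J')(ℓ(h) + 3), hence at least ℓ(h) + 2 later than copy J.  The size bound
-- follows from ℓ(h) + 3 ≤ 3 (d + 1)^h.
module Submission where

open import Defs
open import Data.Nat
  using (ℕ; zero; suc; _+_; _*_; _^_; _∸_; pred; _≤_; _<_; z≤n; s≤s; z<s; NonZero; >-nonZero; _<?_; _≤?_; _≟_)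
open import Data.Nat.Properties
open import Data.Nat.DivMod
  using (_/_; _%_; m%n<n; m<n⇒m%n≡m; [m+kn]%n≡m%n; +-distrib-/; m*n/n≡m; m*n%n≡0; m<n⇒m/n≡0; m<n*o⇒m/o<n; m≡m%n+[m/n]*n)
open import Data.Nat.Solver using (module +-*-Solver)
open +-*-Solver using (solve; _:+_; _:*_; con; _:=_)
open import Data.Product using (Σ; _×_; _,_; proj₁; proj₂)
open import Data.Sum using (_⊎_; inj₁; inj₂)
open import Data.Empty using (⊥-elim)
open import Data.List using (List; []; _∷_; _++_; length; map; concat; applyUpTo)
open import Data.List.Properties using (length-++; length-map)
open import Data.List.Relation.Unary.All using (All; []; _∷_)
import Data.List.Relation.Unary.All as All
open import Data.List.Relation.Unary.Any using (here; there)
open import Data.List.Relation.Unary.Any.Properties using (applyUpTo⁺; applyUpTo⁻)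
open import Data.List.Membership.Propositional using (_∈_; _∉_)
open import Data.List.Membership.Propositional.Properties
  using (∈-++⁺ˡ; ∈-++⁺ʳ; ∈-++⁻; ∈-map⁺; ∈-map⁻; ∈-concat⁺; ∈-concat⁻; ∈-applyUpTo⁺; ∈-applyUpTo⁻)
open import Relation.Binary.PropositionalEquality
  using (_≡_; _≢_; refl; sym; trans; cong; cong₂; subst; subst₂; module ≡-Reasoning)
open import Relation.Binary.Definitions using (Tri; tri<; tri≈; tri>)
open import Relation.Nullary using (yes; no; ¬_)

Close : ℕ → ℕ → Set
Close x y = x ≤ suc y × y ≤ suc x

close-suc : ∀ {x y} → y ≡ suc x → Close x y
close-suc refl = m≤n⇒m≤1+n (n≤1+n _) , ≤-refl

close-≡ : ∀ {x y} → x ≡ y → Close x y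
close-≡ refl = n≤1+n _ , n≤1+n _

close-+ : ∀ b {x y} → Close x y → Close (b + x) (b + y)
close-+ b {x} {y} (x≤1+y , y≤1+x) =
  ≤-trans (+-monoʳ-≤ b x≤1+y) (≤-reflexive (+-suc b y)) ,
  ≤-trans (+-monoʳ-≤ b y≤1+x) (≤-reflexive (+-suc b x))

Lipschitz : List Edge → List Edge → (ℕ → ℕ) → Set
Lipschitz E F φ = ∀ u v → (u , v) ∈ E → (u , v) ∉ F → Close (φ u) (φ v)

infix 4 _∈_∖_
_∈_∖_ : Edge → List Edge → List Edge → Set
e ∈ E ∖ F = e ∈ E × e ∉ F

adj : ∀ {E F u v} → (u , v) ∈ E ∖ F → Adj E F u v
adj (e∈E , e∉F) = _ , e∈E , e∉F , inj₁ refl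

adj-lipschitz : ∀ {E F φ u v} → Lipschitz E F φ → Adj E F u v → φ v ≤ suc (φ u)
adj-lipschitz φ-lip ((a , b) , e∈E , e∉F , inj₁ refl) = proj₂ (φ-lip a b e∈E e∉F)
adj-lipschitz φ-lip ((a , b) , e∈E , e∉F , inj₂ refl) = proj₁ (φ-lip a b e∈E e∉F)

walk-potential : ∀ {E F φ u w n} → Lipschitz E F φ → Walk E F u w n → φ w ≤ φ u + n
walk-potential φ-lip here = ≤-reflexive (sym (+-identityʳ _))
walk-potential {φ = φ} {u} φ-lip (step {n = n} a w) = begin
  _              ≤⟨ walk-potential φ-lip w ⟩
  _ + n          ≤⟨ +-monoˡ-≤ n (adj-lipschitz φ-lip a) ⟩
  suc (φ u) + n  ≡⟨ +-suc (φ u) n ⟨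
  φ u + suc n    ∎
  where open ≤-Reasoning

walk-length-≥-potential : ∀ {E F φ u w n} → Lipschitz E F φ → φ u ≡ 0 → Walk E F u w n → φ w ≤ n
walk-length-≥-potential {φ = φ} {w = w} {n} φ-lip φu≡0 p =
  subst (λ z → φ w ≤ z + n) φu≡0 (walk-potential φ-lip p)

_++ʷ_ : ∀ {E F u v w n m} → Walk E F u v n → Walk E F v w m → Walk E F u w (n + m)
here     ++ʷ q = q
step a p ++ʷ q = step a (p ++ʷ q)

mapʷ : ∀ {E F E′ F′} (f : ℕ → ℕ) → (∀ {u v} → Adj E F u v → Adj E′ F′ (f u) (f v)) →
       ∀ {u w n} → Walk E F u w n → Walk E′ F′ (f u) (f w) n
mapʷ f f-adj here       = here
mapʷ f f-adj (step a p) = step (f-adj a) (mapʷ f f-adj p)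

shiftEdge-injective : ∀ o {e e′} → shiftEdge o e ≡ shiftEdge o e′ → e ≡ e′
shiftEdge-injective o {a , b} {a′ , b′} eq =
  cong₂ _,_ (+-cancelˡ-≡ o a a′ (cong proj₁ eq)) (+-cancelˡ-≡ o b b′ (cong proj₂ eq))

module _ {A : Set} (f : ℕ → List A) where

  ∈-concat-applyUpTo⁻ : ∀ n {x} → x ∈ concat (applyUpTo f n) → Σ ℕ λ j → j < n × x ∈ f j
  ∈-concat-applyUpTo⁻ n p = applyUpTo⁻ f (∈-concat⁻ (applyUpTo f n) p)

  ∈-concat-applyUpTo⁺ : ∀ {n x j} → j < n → x ∈ f j → x ∈ concat (applyUpTo f n)
  ∈-concat-applyUpTo⁺ j<n x∈fj = ∈-concat⁺ (applyUpTo⁺ f x∈fj j<n)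

length-concat-applyUpTo : ∀ {A : Set} (f : ℕ → List A) n c → (∀ j → length (f j) ≡ c) →
                          length (concat (applyUpTo f n)) ≡ n * c
length-concat-applyUpTo f zero    c |f|≡c = refl
length-concat-applyUpTo f (suc n) c |f|≡c = trans (length-++ (f 0))
  (cong₂ _+_ (|f|≡c 0) (length-concat-applyUpTo (λ i → f (suc i)) n c (λ j → |f|≡c (suc j))))

PathIn : List Edge → List Edge → ℕ → ℕ → ℕ → ℕ → Set
PathIn E F a b m s = All (_∈ E ∖ F) (pathEdges a b m s)

pathEdges-walk : ∀ {E F} a b m s → 1 ≤ m → PathIn E F a b m s → Walk E F a b m
pathEdges-walk a b (suc zero)    s _ (ab-open ∷ _)    = step (adj ab-open) here
pathEdges-walk a b (suc (suc m)) s _ (as-open ∷ rest) = step (adj as-open) (pathEdges-walk s b (suc m) (suc s) (s≤s z≤n) rest)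

pathEdges-walk-inner : ∀ {E F} a b m s t → suc t < m → PathIn E F a b m s → Walk E F a (t + s) (suc t)
pathEdges-walk-inner a b (suc zero)    s t       (s≤s ()) _
pathEdges-walk-inner a b (suc (suc m)) s zero    _ (as-open ∷ _) = step (adj as-open) here
pathEdges-walk-inner {E} {F} a b (suc (suc m)) s (suc t) (s≤s t<m) (as-open ∷ rest) =
  step (adj as-open) (subst (λ z → Walk E F s z (suc t)) (+-suc t s) (pathEdges-walk-inner s b (suc m) (suc s) t t<m rest))

pathEdges-close : ∀ (g f : ℕ → ℕ) a b m s → (∀ t → Close (f t) (f (suc t))) →
  g a ≡ f 0 → (∀ t → suc t < m → g (t + s) ≡ f (suc t)) → g b ≡ f m →
  ∀ u v → (u , v) ∈ pathEdges a b m s → Close (g u) (g v)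
pathEdges-close g f a b (suc zero) s f-close ga gs gb u v (here refl) =
  subst₂ Close (sym ga) (sym gb) (f-close 0)
pathEdges-close g f a b (suc (suc m)) s f-close ga gs gb u v (here refl) =
  subst₂ Close (sym ga) (sym (gs 0 (s≤s (s≤s z≤n)))) (f-close 0)
pathEdges-close g f a b (suc (suc m)) s f-close ga gs gb u v (there p) =
  pathEdges-close g (λ t → f (suc t)) s b (suc m) (suc s) (λ t → f-close (suc t))
    (gs 0 (s≤s (s≤s z≤n))) (λ t t<m → trans (cong g (+-suc t s)) (gs (suc t) (s≤s t<m))) gb u v p

pathEdges-fresh : ∀ {t} a b m s → t ≤ s → t ≤ a ⊎ 2 ≤ m →
                  ∀ u v → (u , v) ∈ pathEdges a b m s → t ≤ u ⊎ t ≤ v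
pathEdges-fresh a b (suc zero)    s t≤s (inj₁ t≤a) u v (here refl) = inj₁ t≤a
pathEdges-fresh a b (suc zero)    s t≤s (inj₂ (s≤s ())) u v (here refl)
pathEdges-fresh a b (suc (suc m)) s t≤s _          u v (here refl) = inj₂ t≤s
pathEdges-fresh a b (suc (suc m)) s t≤s _          u v (there p)   =
  pathEdges-fresh s b (suc m) (suc s) (m≤n⇒m≤1+n t≤s) (inj₁ t≤s) u v p

pathEdges-< : ∀ B a b m s → a < B → b < B → s + pred m ≤ B →
              ∀ u v → (u , v) ∈ pathEdges a b m s → u < B × v < B
pathEdges-< B a b (suc zero)    s a<B b<B _ u v (here refl) = a<B , b<B
pathEdges-< B a b (suc (suc m)) s a<B b<B s+m+1≤B u v (here refl) =
  a<B , ≤-trans (m<m+n s z<s) s+m+1≤B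
pathEdges-< B a b (suc (suc m)) s a<B b<B s+m+1≤B u v (there p) =
  pathEdges-< B s b (suc m) (suc s) (≤-trans (m<m+n s z<s) s+m+1≤B) b<B
    (≤-trans (≤-reflexive (sym (+-suc s m))) s+m+1≤B) u v p

block-< : ∀ {N c n u} → c < n → u < N → c * N + u < n * N
block-< {N} {c} {n} {u} c<n u<N = begin-strict
  c * N + u  <⟨ +-monoʳ-< (c * N) u<N ⟩
  c * N + N  ≡⟨ +-comm (c * N) N ⟩
  suc c * N  ≤⟨ *-monoˡ-≤ N c<n ⟩
  n * N      ∎
  where open ≤-Reasoning

module _ {N : ℕ} .{{_ : NonZero N}} where

  block-% : ∀ c {u} → u < N → (c * N + u) % N ≡ u
  block-% c {u} u<N = begin
    (c * N + u) % N  ≡⟨ cong (_% N) (+-comm (c * N) u) ⟩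
    (u + c * N) % N  ≡⟨ [m+kn]%n≡m%n u c N ⟩
    u % N            ≡⟨ m<n⇒m%n≡m u<N ⟩
    u                ∎
    where open ≡-Reasoning

  block-/ : ∀ c {u} → u < N → (c * N + u) / N ≡ c
  block-/ c {u} u<N = begin
    (c * N + u) / N    ≡⟨ +-distrib-/ (c * N) u (subst₂ (λ a b → a + b < N) (sym (m*n%n≡0 c N)) (sym (m<n⇒m%n≡m u<N)) u<N) ⟩
    c * N / N + u / N  ≡⟨ cong₂ _+_ (m*n/n≡m c N) (m<n⇒m/n≡0 u<N) ⟩
    c + 0              ≡⟨ +-identityʳ c ⟩
    c                  ∎
    where open ≡-Reasoning

  block-decompose : ∀ {n x} → x < n * N → Σ ℕ λ c → Σ ℕ λ u → c < n × u < N × x ≡ c * N + u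
  block-decompose {n} {x} x<nN = x / N , x % N , m<n*o⇒m/o<n x<nN , m%n<n x N ,
    trans (m≡m%n+[m/n]*n x N) (+-comm (x % N) (x / N * N))

-- ℓ(h) ≤ maxHeight d h: the spine, a connecting path and a copy of 𝒯^h in turn
maxHeight : ℕ → ℕ → ℕ
maxHeight d zero    = 0
maxHeight d (suc h) = d * (maxHeight d h + 3) + maxHeight d h

maxHeight+3≡ : ∀ d h → maxHeight d h + 3 ≡ 3 * (d + 1) ^ h
maxHeight+3≡ d zero    = refl
maxHeight+3≡ d (suc h) = begin
  d * (X + 3) + X + 3          ≡⟨ solve 2 (λ d x → d :* (x :+ con 3) :+ x :+ con 3 := (d :+ con 1) :* (x :+ con 3)) refl d X ⟩
  (d + 1) * (X + 3)            ≡⟨ cong ((d + 1) *_) (maxHeight+3≡ d h) ⟩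
  (d + 1) * (3 * (d + 1) ^ h)  ≡⟨ solve 2 (λ a p → a :* (con 3 :* p) := con 3 :* (a :* p)) refl (d + 1) ((d + 1) ^ h) ⟩
  3 * (d + 1) ^ suc h          ∎
  where open ≡-Reasoning
        X = maxHeight d h

-- the distance from v_0 to the root of copy j, when connecting paths have length (d − j) Q
copyDepth : ℕ → ℕ → ℕ → ℕ
copyDepth d Q j = j + (d ∸ j) * Q

copyDepth-≤ : ∀ d Q j → 1 ≤ Q → j ≤ d → copyDepth d Q j ≤ d * Q
copyDepth-≤ d       Q zero    1≤Q j≤d       = ≤-refl
copyDepth-≤ (suc d) Q (suc j) 1≤Q (s≤s j≤d) = +-mono-≤ 1≤Q (copyDepth-≤ d Q j 1≤Q j≤d)

copyDepth-gap : ∀ d Q i j → i < j → j ≤ d → 1 ≤ Q → copyDepth d Q j + pred Q ≤ copyDepth d Q i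
copyDepth-gap (suc d) (suc Q) zero (suc j) _ (s≤s j≤d) _ = s≤s (begin
  copyDepth d (suc Q) j + Q    ≤⟨ +-monoˡ-≤ Q (copyDepth-≤ d (suc Q) j (s≤s z≤n) j≤d) ⟩
  d * suc Q + Q                ≡⟨ +-comm (d * suc Q) Q ⟩
  Q + d * suc Q                ∎)
  where open ≤-Reasoning
copyDepth-gap (suc d) Q (suc i) (suc j) (s≤s i<j) (s≤s j≤d) 1≤Q = s≤s (copyDepth-gap d Q i j i<j j≤d 1≤Q)

size-step-bound : ∀ d h N Q S → 2 * N ≤ 3 * ((h + 1) * (d + 1) ^ (h + 1)) → Q ≤ 3 * (d + 1) ^ h →
                  2 * S ≡ Q * (d * (d + 1)) →
                  2 * ((d * N + d) + S) ≤ 3 * ((suc h + 1) * (d + 1) ^ (suc h + 1))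
size-step-bound d h N Q S 2N≤ Q≤3P 2S≡ = begin
  2 * ((d * N + d) + S)
    ≡⟨ solve 3 (λ d n s → con 2 :* ((d :* n :+ d) :+ s) := d :* (con 2 :* n) :+ con 2 :* d :+ con 2 :* s) refl d N S ⟩
  d * (2 * N) + 2 * d + 2 * S
    ≡⟨ cong (d * (2 * N) + 2 * d +_) 2S≡ ⟩
  d * (2 * N) + 2 * d + Q * (d * (d + 1))
    ≤⟨ +-mono-≤ (+-mono-≤ (*-monoʳ-≤ d (subst (λ z → 2 * N ≤ 3 * ((h + 1) * z)) power-step 2N≤)) 2d≤)
                (*-monoˡ-≤ (d * (d + 1)) Q≤3P) ⟩
  d * (3 * ((h + 1) * ((d + 1) * P))) + (3 * (d + 1)) * ((h + 2) * P) + (3 * P) * (d * (d + 1))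
    ≡⟨ solve 3 (λ d h p → d :* (con 3 :* ((h :+ con 1) :* ((d :+ con 1) :* p))) :+ (con 3 :* (d :+ con 1)) :* ((h :+ con 2) :* p) :+ (con 3 :* p) :* (d :* (d :+ con 1))
                         := con 3 :* ((con 1 :+ (h :+ con 1)) :* ((d :+ con 1) :* ((d :+ con 1) :* p)))) refl d h P ⟩
  3 * (suc (h + 1) * ((d + 1) * ((d + 1) * P)))
    ≡⟨ cong (λ z → 3 * (suc (h + 1) * ((d + 1) * z))) power-step ⟨
  3 * (suc (h + 1) * ((d + 1) * (d + 1) ^ (h + 1)))
    ∎
  where
    open ≤-Reasoning
    P = (d + 1) ^ h
    power-step : (d + 1) ^ (h + 1) ≡ (d + 1) * P
    power-step = cong ((d + 1) ^_) (+-comm h 1)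
    2d≤ : 2 * d ≤ (3 * (d + 1)) * ((h + 2) * P)
    2d≤ = begin
      2 * d                          ≤⟨ m≤m+n (2 * d) (d + 3) ⟩
      2 * d + (d + 3)                ≡⟨ solve 1 (λ d → con 2 :* d :+ (d :+ con 3) := con 3 :* (d :+ con 1)) refl d ⟩
      3 * (d + 1)                    ≡⟨ *-identityʳ (3 * (d + 1)) ⟨
      3 * (d + 1) * 1                ≤⟨ *-monoʳ-≤ (3 * (d + 1)) (*-mono-≤ (≤-trans (s≤s z≤n) (m≤n+m 2 h))
                                                                            (m^n>0 (d + 1) ⦃ >-nonZero (m≤n+m 1 d) ⦄ h)) ⟩
      (3 * (d + 1)) * ((h + 2) * P)  ∎

record LeafCertificate (h : ℕ) (T : Tree) (level : ℕ → ℕ) (ℓ : ℕ) : Set where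
  field
    cut                 : List Edge
    cut⊆edges           : All (_∈ edges T) cut
    |cut|≤h             : length cut ≤ h
    depth               : ℕ
    walk                : Walk (edges T) cut (root T) ℓ depth
    -- bounds depth by the height, which keeps the cut-off part of 𝒯^{h+1} far enough
    depth≤level         : depth ≤ level ℓ
    potential           : ℕ → ℕ
    potential-root      : potential (root T) ≡ 0
    potential-lipschitz : Lipschitz (edges T) cut potential
    depth≤potential     : depth ≤ potential ℓ
    potential-leaves    : ∀ ℓ′ → ℓ′ ∈ leaves T → ℓ′ ≢ ℓ → depth + 2 ≤ potential ℓ′

record Invariant (d h : ℕ) (T : Tree) : Set where
  field
    root<size       : root T < size T
    leaf<size       : ∀ x → x ∈ leaves T → x < size T
    edge<size       : ∀ u v → (u , v) ∈ edges T → u < size T × v < size T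
    reachable       : ∀ x → x < size T → Σ ℕ λ m → m ≤ maxHeight d h × Walk (edges T) [] (root T) x m
    level           : ℕ → ℕ
    level-root      : level (root T) ≡ 0
    level-lipschitz : Lipschitz (edges T) [] level
    size-bound      : 2 * size T ≤ 3 * ((h + 1) * (d + 1) ^ (h + 1))
    leaf-count      : length (leaves T) ≡ d ^ h
    certificate     : ∀ ℓ → ℓ ∈ leaves T → LeafCertificate h T level ℓ

invariant-T0 : ∀ d → 1 ≤ d → Invariant d 0 T0
invariant-T0 d 1≤d = record
  { root<size       = s≤s z≤n
  ; leaf<size       = λ { x (here refl) → s≤s z≤n }
  ; edge<size       = λ u v ()
  ; reachable       = λ { zero _ → 0 , z≤n , here ; (suc x) (s≤s ()) }
  ; level           = λ _ → 0
  ; level-root      = refl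
  ; level-lipschitz = λ u v ()
  ; size-bound      = ≤-trans (n≤1+n 2) (*-monoʳ-≤ 3 (*-monoʳ-≤ 1 (*-monoˡ-≤ 1 (m≤n+m 1 d))))
  ; leaf-count      = refl
  ; certificate     = λ { x (here refl) → record
      { cut = [] ; cut⊆edges = [] ; |cut|≤h = z≤n ; depth = 0 ; walk = here ; depth≤level = z≤n
      ; potential = λ _ → 0 ; potential-root = refl ; potential-lipschitz = λ u v () ; depth≤potential = z≤n
      ; potential-leaves = λ { ℓ (here refl) ℓ≢0 → ⊥-elim (ℓ≢0 refl) } } }
  }

module Extend (d : ℕ) (1≤d : 1 ≤ d) (h : ℕ) (T : Tree) (K : ℕ)
              (inv : Invariant d h T) (height : IsHeight T K) where

  open Invariant inv
  open Build d T K using (v; copyEdges; spineEdges; conns; connResult; tree; copyLeaves)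

  N : ℕ
  N = size T

  E E′ : List Edge
  E  = edges T
  E′ = edges tree

  private instance
    N-nonZero : NonZero N
    N-nonZero = >-nonZero (≤-trans (s≤s z≤n) root<size)

  len : ℕ → ℕ
  len j = (d ∸ j) * (K + 3)

  depthOf : ℕ → ℕ
  depthOf = copyDepth d (K + 3)

  far : ℕ
  far = suc d * (K + 3)

  fresh₀ : ℕ
  fresh₀ = d * N + d

  1≤K+3 : 1 ≤ K + 3
  1≤K+3 = ≤-trans (s≤s z≤n) (m≤n+m 3 K)

  3≤len : ∀ {j} → j < d → 3 ≤ len j
  3≤len {j} j<d = begin
    3                  ≤⟨ m≤n+m 3 K ⟩
    K + 3              ≡⟨ *-identityˡ (K + 3) ⟨
    1 * (K + 3)        ≤⟨ *-monoˡ-≤ (K + 3) (m<n⇒0<n∸m j<d) ⟩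
    (d ∸ j) * (K + 3)  ∎
    where open ≤-Reasoning

  K≤maxHeight : K ≤ maxHeight d h
  K≤maxHeight with (x , x<N , _ , K-minimal) ← proj₁ height with (m , m≤ , w) ← reachable x x<N =
    ≤-trans (K-minimal m w) m≤

  level≤K : ∀ {y} → y < N → level y ≤ K
  level≤K y<N with (m , m≤K , w , _) ← proj₂ height _ y<N =
    ≤-trans (walk-length-≥-potential level-lipschitz level-root w) m≤K

  copy<fresh₀ : ∀ {c u} → c < d → u < N → c * N + u < fresh₀
  copy<fresh₀ c<d u<N = ≤-trans (block-< c<d u<N) (m≤m+n (d * N) d)

  v<fresh₀ : ∀ {j} → j < d → v j < fresh₀
  v<fresh₀ j<d = +-monoʳ-< (d * N) j<d

  data EdgeView : Edge → Set where
    copyEdge      : ∀ {c u w} → c < d → (u , w) ∈ E → EdgeView (c * N + u , c * N + w)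
    spineEdge     : ∀ {i} → suc i < d → EdgeView (v i , v (suc i))
    connectorEdge : ∀ {e} → e ∈ proj₁ connResult → EdgeView e

  edgeView : ∀ {e} → e ∈ E′ → EdgeView e
  edgeView p with ∈-++⁻ copyEdges p
  ... | inj₁ q with (c , c<d , r) ← ∈-concat-applyUpTo⁻ (λ j → map (shiftEdge (j * N)) E) d q
               with (_ , e∈E , refl) ← ∈-map⁻ (shiftEdge (c * N)) r = copyEdge c<d e∈E
  ... | inj₂ q with ∈-++⁻ spineEdges q
  ...   | inj₂ r = connectorEdge r
  ...   | inj₁ r with (i , i<d-1 , refl) ← ∈-applyUpTo⁻ (λ j → (v j , v (suc j))) r = spineEdge (pred-cancel-< i<d-1)

  copyEdge∈ : ∀ {J e} → J < d → e ∈ E → shiftEdge (J * N) e ∈ E′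
  copyEdge∈ J<d e∈E = ∈-++⁺ˡ (∈-concat-applyUpTo⁺ (λ j → map (shiftEdge (j * N)) E) J<d (∈-map⁺ _ e∈E))

  spineEdge∈ : ∀ {i} → suc i < d → (v i , v (suc i)) ∈ E′
  spineEdge∈ i+1<d = ∈-++⁺ʳ copyEdges (∈-++⁺ˡ (∈-applyUpTo⁺ (λ j → (v j , v (suc j))) (<⇒≤pred i+1<d)))

  data CopyLeaf : ℕ → Set where
    copyLeaf : ∀ {c y} → c < d → y ∈ leaves T → CopyLeaf (c * N + y)

  copyLeaf? : ∀ {ℓ} → ℓ ∈ copyLeaves → CopyLeaf ℓ
  copyLeaf? p with (c , c<d , q) ← ∈-concat-applyUpTo⁻ (λ j → map (j * N +_) (leaves T)) d p
              with (y , y∈ , refl) ← ∈-map⁻ (c * N +_) q = copyLeaf c<d y∈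

  -- Suffix j f s: conns j f s is the tail of the connecting paths, f of them, fresh nodes from s
  data Suffix : ℕ → ℕ → ℕ → Set where
    start : Suffix 0 d fresh₀
    next  : ∀ {j f s} → Suffix j (suc f) s → Suffix (suc j) f (s + pred (len j))

  suffix-+ : ∀ {j f s} → Suffix j f s → j + f ≡ d
  suffix-+ start                = refl
  suffix-+ (next {j} {f} σ) = trans (sym (+-suc j f)) (suffix-+ σ)

  suffix-< : ∀ {j f s} → Suffix j (suc f) s → j < d
  suffix-< {j} {f} σ = subst (j <_) (suffix-+ σ) (m<m+n j z<s)

  suffix-fresh : ∀ {j f s} → Suffix j f s → fresh₀ ≤ s
  suffix-fresh start    = ≤-refl
  suffix-fresh (next σ) = ≤-trans (suffix-fresh σ) (m≤m+n _ _)

  suffix-⊆ : ∀ {j f s e} → Suffix j f s → e ∈ proj₁ (conns j f s) → e ∈ E′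
  suffix-⊆ start                p = ∈-++⁺ʳ copyEdges (∈-++⁺ʳ spineEdges p)
  suffix-⊆ (next {j} {s = s} σ) p = suffix-⊆ σ (∈-++⁺ʳ (pathEdges (v j) (j * N + root T) (len j) s) p)

  copyPotential : ℕ → (ℕ → ℕ) → ℕ → ℕ → ℕ
  copyPotential J ψ c u with <-cmp c J
  ... | tri< _ _ _ = depthOf c + level u
  ... | tri≈ _ _ _ = depthOf J + ψ u
  ... | tri> _ _ _ = far

  copyPotential-< : ∀ J ψ {c} u → c < J → copyPotential J ψ c u ≡ depthOf c + level u
  copyPotential-< J ψ {c} u c<J with <-cmp c J
  ... | tri< _ _ _   = refl
  ... | tri≈ c≮J _ _ = ⊥-elim (c≮J c<J)
  ... | tri> c≮J _ _ = ⊥-elim (c≮J c<J)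

  copyPotential-≡ : ∀ J ψ u → copyPotential J ψ J u ≡ depthOf J + ψ u
  copyPotential-≡ J ψ u with <-cmp J J
  ... | tri< _ J≢J _ = ⊥-elim (J≢J refl)
  ... | tri≈ _ _ _   = refl
  ... | tri> _ J≢J _ = ⊥-elim (J≢J refl)

  copyPotential-> : ∀ J ψ {c} u → J < c → copyPotential J ψ c u ≡ far
  copyPotential-> J ψ {c} u J<c with <-cmp c J
  ... | tri< _ _ J≮c = ⊥-elim (J≮c J<c)
  ... | tri≈ _ _ J≮c = ⊥-elim (J≮c J<c)
  ... | tri> _ _ _   = refl

  gate : ℕ → ℕ → ℕ → ℕ
  gate J j x with j ≤? J
  ... | yes _ = x
  ... | no  _ = far

  gate-≤ : ∀ {J j} x → j ≤ J → gate J j x ≡ x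
  gate-≤ {J} {j} x j≤J with j ≤? J
  ... | yes _   = refl
  ... | no j≰J = ⊥-elim (j≰J j≤J)

  gate-≰ : ∀ {J j} x → ¬ j ≤ J → gate J j x ≡ far
  gate-≰ {J} {j} x j≰J with j ≤? J
  ... | yes j≤J = ⊥-elim (j≰J j≤J)
  ... | no _    = refl

  connectorPotential : ℕ → ℕ → ℕ → ℕ → ℕ → ℕ
  connectorPotential J j zero    s x = far
  connectorPotential J j (suc f) s x with x <? s + pred (len j)
  ... | yes _ = gate J j (suc (x ∸ s + j))
  ... | no  _ = connectorPotential J (suc j) f (s + pred (len j)) x

  connectorPotential-inner : ∀ J j f s t → t < pred (len j) →
                             connectorPotential J j (suc f) s (t + s) ≡ gate J j (suc (t + j))
  connectorPotential-inner J j f s t t<len with t + s <? s + pred (len j)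
  ... | yes _ = cong (λ z → gate J j (suc (z + j))) (m+n∸n≡m t s)
  ... | no t+s≮ = ⊥-elim (t+s≮ (subst (_< s + pred (len j)) (+-comm s t) (+-monoʳ-< s t<len)))

  connectorPotential-outer : ∀ J j f s x → s + pred (len j) ≤ x →
                             connectorPotential J j (suc f) s x ≡ connectorPotential J (suc j) f (s + pred (len j)) x
  connectorPotential-outer J j f s x s+len≤x with x <? s + pred (len j)
  ... | yes x< = ⊥-elim (<⇒≱ x< s+len≤x)
  ... | no _   = refl

  -- Copies occupy the nodes below d N, the spine the next d, connecting paths start at
  -- fresh₀.  potential J ψ serves a leaf of copy J whose certificate has potential ψ;
  -- far marks what the cut separates from the root.  potential d level is the new level.
  potential : ℕ → (ℕ → ℕ) → ℕ → ℕ
  potential J ψ x with x <? d * N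
  ... | yes _ = copyPotential J ψ (x / N) (x % N)
  ... | no _ with x <? fresh₀
  ...   | yes _ = gate J (x ∸ d * N) (x ∸ d * N)
  ...   | no _  = connectorPotential J 0 d fresh₀ x

  potential-copy : ∀ J ψ {c u} → c < d → u < N → potential J ψ (c * N + u) ≡ copyPotential J ψ c u
  potential-copy J ψ {c} {u} c<d u<N with c * N + u <? d * N
  ... | yes _ = cong₂ (copyPotential J ψ) (block-/ c u<N) (block-% c u<N)
  ... | no ≮  = ⊥-elim (≮ (block-< c<d u<N))

  potential-spine : ∀ J ψ {i} → i < d → potential J ψ (v i) ≡ gate J i i
  potential-spine J ψ {i} i<d with v i <? d * N
  ... | yes v<dN = ⊥-elim (m+n≮m (d * N) i v<dN)
  ... | no _ with v i <? fresh₀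
  ...   | yes _ = cong (λ z → gate J z z) (m+n∸m≡n (d * N) i)
  ...   | no ≮  = ⊥-elim (≮ (v<fresh₀ i<d))

  potential-connectors : ∀ J ψ {j f s x} → Suffix j f s → s ≤ x → potential J ψ x ≡ connectorPotential J j f s x
  potential-connectors J ψ {x = x} start fresh₀≤x with x <? d * N
  ... | yes x<dN = ⊥-elim (<⇒≱ (≤-trans x<dN (m≤m+n (d * N) d)) fresh₀≤x)
  ... | no _ with x <? fresh₀
  ...   | yes x<  = ⊥-elim (<⇒≱ x< fresh₀≤x)
  ...   | no _    = refl
  potential-connectors J ψ {x = x} (next {j} {f} {s} σ) s′≤x =
    trans (potential-connectors J ψ σ (≤-trans (m≤m+n s _) s′≤x)) (connectorPotential-outer J j f s x s′≤x)

  potential-copyRoot : ∀ J ψ {j} → ψ (root T) ≡ 0 → j ≤ J → j < d → potential J ψ (j * N + root T) ≡ len j + j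
  potential-copyRoot J ψ {j} ψ-root j≤J j<d = trans (potential-copy J ψ j<d root<size) (root-value (<-cmp j J))
    where
      root-value : Tri (j < J) (j ≡ J) (J < j) → copyPotential J ψ j (root T) ≡ len j + j
      root-value (tri< j<J _ _) = trans (copyPotential-< J ψ (root T) j<J)
        (trans (cong (depthOf j +_) level-root) (trans (+-identityʳ _) (+-comm j (len j))))
      root-value (tri≈ _ refl _) = trans (copyPotential-≡ J ψ (root T))
        (trans (cong (depthOf J +_) ψ-root) (trans (+-identityʳ _) (+-comm J (len J))))
      root-value (tri> _ _ J<j) = ⊥-elim (<⇒≱ J<j j≤J)

  module _ (J : ℕ) (ψ : ℕ → ℕ) (F F′ : List Edge) (ψ-lip : Lipschitz E F ψ) (ψ-root : ψ (root T) ≡ 0)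
           (inherit : ∀ e → e ∈ F → shiftEdge (J * N) e ∈ F′)
           (spine-cut : suc J < d → (v J , v (suc J)) ∈ F′) where

    copy-close : ∀ c {u w} → (u , w) ∈ E → (c * N + u , c * N + w) ∉ F′ →
                 Close (copyPotential J ψ c u) (copyPotential J ψ c w)
    copy-close c {u} {w} e∈E e∉F′ with <-cmp c J
    ... | tri< _ _ _    = close-+ (depthOf c) (level-lipschitz u w e∈E λ ())
    ... | tri≈ _ refl _ = close-+ (depthOf J) (ψ-lip u w e∈E (λ e∈F → e∉F′ (inherit _ e∈F)))
    ... | tri> _ _ _    = close-≡ refl

    spine-close : ∀ {i} → suc i < d → (v i , v (suc i)) ∉ F′ → Close (gate J i i) (gate J (suc i) (suc i))
    spine-close {i} i+1<d e∉F′ with i ≤? J | suc i ≤? J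
    ... | yes _   | yes _      = close-suc refl
    ... | no i≰J  | yes i<J    = ⊥-elim (i≰J (<⇒≤ i<J))
    ... | no _    | no _       = close-≡ refl
    ... | yes i≤J | no i+1≰J   = ⊥-elim (e∉F′ (subst (λ z → (v z , v (suc z)) ∈ F′) (sym i≡J)
                                   (spine-cut (subst (λ z → suc z < d) i≡J i+1<d))))
      where i≡J = ≤-antisym i≤J (≮⇒≥ i+1≰J)

    -- along a connecting path the potential either climbs by one per edge or is constantly far
    connectors-close : ∀ {j f s} → Suffix j f s → ∀ u w → (u , w) ∈ proj₁ (conns j f s) →
                       Close (potential J ψ u) (potential J ψ w)
    connectors-close {j} {suc f} {s} σ u w p with ∈-++⁻ (pathEdges (v j) (j * N + root T) (len j) s) p
    ... | inj₂ q = connectors-close (next σ) u w q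
    ... | inj₁ q with j ≤? J
    ...   | yes j≤J = pathEdges-close (potential J ψ) (_+ j) (v j) (j * N + root T) (len j) s
                        (λ t → close-suc refl)
                        (trans (potential-spine J ψ (suffix-< σ)) (gate-≤ j j≤J))
                        (λ t t+1<len → trans (potential-connectors J ψ σ (m≤n+m s t))
                          (trans (connectorPotential-inner J j f s t (pred-mono-≤ t+1<len)) (gate-≤ _ j≤J)))
                        (potential-copyRoot J ψ ψ-root j≤J (suffix-< σ)) u w q
    ...   | no j≰J  = pathEdges-close (potential J ψ) (λ _ → far) (v j) (j * N + root T) (len j) s
                        (λ t → close-≡ refl)
                        (trans (potential-spine J ψ (suffix-< σ)) (gate-≰ j j≰J))
                        (λ t t+1<len → trans (potential-connectors J ψ σ (m≤n+m s t))
                          (trans (connectorPotential-inner J j f s t (pred-mono-≤ t+1<len)) (gate-≰ _ j≰J)))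
                        (trans (potential-copy J ψ (suffix-< σ) root<size) (copyPotential-> J ψ (root T) (≰⇒> j≰J))) u w q

    potential-lipschitz : Lipschitz E′ F′ (potential J ψ)
    potential-lipschitz u w p e∉F′ with edgeView p
    ... | copyEdge {c} {u₀} {w₀} c<d e∈E =
      subst₂ Close (sym (potential-copy J ψ c<d (proj₁ (edge<size u₀ w₀ e∈E))))
                   (sym (potential-copy J ψ c<d (proj₂ (edge<size u₀ w₀ e∈E))))
                   (copy-close c e∈E e∉F′)
    ... | spineEdge i+1<d =
      subst₂ Close (sym (potential-spine J ψ (≤-trans (n≤1+n _) i+1<d))) (sym (potential-spine J ψ i+1<d))
                   (spine-close i+1<d e∉F′)
    ... | connectorEdge r = connectors-close start u w r

  copy-adj : ∀ {J F F′ u w} → J < d → (∀ e → e ∈ E → shiftEdge (J * N) e ∈ F′ → e ∈ F) →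
             Adj E F u w → Adj E′ F′ (J * N + u) (J * N + w)
  copy-adj J<d reflect (e , e∈E , e∉F , inj₁ refl) = _ , copyEdge∈ J<d e∈E , (λ e′∈F′ → e∉F (reflect e e∈E e′∈F′)) , inj₁ refl
  copy-adj J<d reflect (e , e∈E , e∉F , inj₂ refl) = _ , copyEdge∈ J<d e∈E , (λ e′∈F′ → e∉F (reflect e e∈E e′∈F′)) , inj₂ refl

  spine-walk : ∀ {F′} J → J < d → (∀ i → i < J → (v i , v (suc i)) ∉ F′) → Walk E′ F′ (v 0) (v J) J
  spine-walk {F′} J J<d spine-open = go 0 J refl
    where
      go : ∀ i r → i + r ≡ J → Walk E′ F′ (v i) (v J) r
      go i zero    i+0≡J = subst (λ z → Walk E′ F′ (v i) (v z) 0) (trans (sym (+-identityʳ i)) i+0≡J) here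
      go i (suc r) i+r≡J = step (adj (spineEdge∈ (≤-<-trans i<J J<d) , spine-open i i<J))
                                (go (suc i) r (trans (sym (+-suc i r)) i+r≡J))
        where i<J = subst (i <_) i+r≡J (m<m+n i z<s)

  module _ (F′ : List Edge) (F′<fresh₀ : ∀ a b → (a , b) ∈ F′ → a < fresh₀ × b < fresh₀) where

    connector-open : ∀ {j f s} → Suffix j (suc f) s → PathIn E′ F′ (v j) (j * N + root T) (len j) s
    connector-open {j} {f} {s} σ = All.tabulate edge-open
      where
        edge-open : ∀ {e} → e ∈ pathEdges (v j) (j * N + root T) (len j) s → e ∈ E′ ∖ F′
        edge-open {a , b} p = suffix-⊆ σ (∈-++⁺ˡ p) , ab∉F′
          where
            ab∉F′ : (a , b) ∉ F′
            ab∉F′ ab∈F′ with pathEdges-fresh (v j) (j * N + root T) (len j) s (suffix-fresh σ)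
                               (inj₂ (≤-trans (s≤s (s≤s z≤n)) (3≤len (suffix-< σ)))) a b p
            ... | inj₁ fresh₀≤a = <⇒≱ (proj₁ (F′<fresh₀ a b ab∈F′)) fresh₀≤a
            ... | inj₂ fresh₀≤b = <⇒≱ (proj₂ (F′<fresh₀ a b ab∈F′)) fresh₀≤b

    connector-walk : ∀ {j f s} → Suffix j f s → ∀ {J} → j ≤ J → J < j + f →
                     Walk E′ F′ (v J) (J * N + root T) (len J)
    connector-walk {j} {zero}  σ j≤J J<j+0 = ⊥-elim (<⇒≱ J<j+0 (subst (_≤ _) (sym (+-identityʳ j)) j≤J))
    connector-walk {j} {suc f} {s} σ {J} j≤J J<j+f with j ≟ J
    ... | yes refl = pathEdges-walk _ _ (len j) s (≤-trans (s≤s z≤n) (3≤len (suffix-< σ))) (connector-open σ)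
    ... | no j≢J   = connector-walk (next σ) (≤∧≢⇒< j≤J j≢J) (subst (J <_) (+-suc j f) J<j+f)

  connector-reach : ∀ {j f s x} → Suffix j f s → s ≤ x → x < proj₂ (conns j f s) →
                    Σ ℕ λ n → n ≤ d * (K + 3) × Walk E′ [] (v 0) x n
  connector-reach {j} {zero}      σ s≤x x<s = ⊥-elim (<⇒≱ x<s s≤x)
  connector-reach {j} {suc f} {s} {x} σ s≤x x<end with x <? s + pred (len j)
  ... | no x≮ = connector-reach (next σ) (≮⇒≥ x≮) x<end
  ... | yes x<s+len = j + suc t , n≤ ,
        subst (λ z → Walk E′ [] (v 0) z (j + suc t)) (m∸n+n≡m s≤x)
          (spine-walk j (suffix-< σ) (λ _ _ ()) ++ʷ
           pathEdges-walk-inner (v j) (j * N + root T) (len j) s t t+1<len (connector-open [] (λ _ _ ()) σ))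
    where
      t = x ∸ s
      t+1<len : suc t < len j
      t+1<len = pred-cancel-< (+-cancelˡ-< s t (pred (len j))
        (subst (_< s + pred (len j)) (trans (sym (m∸n+n≡m s≤x)) (+-comm t s)) x<s+len))
      n≤ : j + suc t ≤ d * (K + 3)
      n≤ = ≤-trans (+-monoʳ-≤ j (<⇒≤ t+1<len)) (copyDepth-≤ d (K + 3) j 1≤K+3 (<⇒≤ (suffix-< σ)))

  conns-size-≥ : ∀ j f s → s ≤ proj₂ (conns j f s)
  conns-size-≥ j zero    s = ≤-refl
  conns-size-≥ j (suc f) s = ≤-trans (m≤m+n s _) (conns-size-≥ (suc j) f (s + pred (len j)))

  connectorsLength : ℕ → ℕ → ℕ
  connectorsLength j zero    = 0
  connectorsLength j (suc f) = len j + connectorsLength (suc j) f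

  conns-size-≤ : ∀ j f s → proj₂ (conns j f s) ≤ s + connectorsLength j f
  conns-size-≤ j zero    s = m≤m+n s 0
  conns-size-≤ j (suc f) s = begin
    proj₂ (conns (suc j) f (s + pred (len j)))  ≤⟨ conns-size-≤ (suc j) f (s + pred (len j)) ⟩
    s + pred (len j) + L                        ≤⟨ +-monoˡ-≤ L (+-monoʳ-≤ s pred[n]≤n) ⟩
    s + len j + L                               ≡⟨ +-assoc s (len j) L ⟩
    s + (len j + L)                             ∎
    where open ≤-Reasoning
          L = connectorsLength (suc j) f

  2*connectorsLength : ∀ j f → j + f ≡ d → 2 * connectorsLength j f ≡ (K + 3) * (f * (f + 1))
  2*connectorsLength j zero    j+0≡d = sym (*-zeroʳ (K + 3))
  2*connectorsLength j (suc f) j+f≡d = begin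
    2 * (len j + L)                                  ≡⟨ cong (λ z → 2 * (z * (K + 3) + L)) d∸j≡ ⟩
    2 * (suc f * (K + 3) + L)                        ≡⟨ *-distribˡ-+ 2 (suc f * (K + 3)) L ⟩
    2 * (suc f * (K + 3)) + 2 * L                    ≡⟨ cong (2 * (suc f * (K + 3)) +_) (2*connectorsLength (suc j) f (trans (sym (+-suc j f)) j+f≡d)) ⟩
    2 * (suc f * (K + 3)) + (K + 3) * (f * (f + 1))  ≡⟨ solve 2 (λ f q → con 2 :* ((con 1 :+ f) :* q) :+ q :* (f :* (f :+ con 1))
                                                                := q :* ((con 1 :+ f) :* ((con 1 :+ f) :+ con 1))) refl f (K + 3) ⟩
    (K + 3) * (suc f * (suc f + 1))                  ∎
    where
      open ≡-Reasoning
      L = connectorsLength (suc j) f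
      d∸j≡ : d ∸ j ≡ suc f
      d∸j≡ = trans (cong (_∸ j) (sym j+f≡d)) (m+n∸m≡n j (suc f))

  connector-edge<size : ∀ {j f s} → Suffix j f s → ∀ u w → (u , w) ∈ proj₁ (conns j f s) →
                        u < proj₂ (conns j f s) × w < proj₂ (conns j f s)
  connector-edge<size {j} {suc f} {s} σ u w p with ∈-++⁻ (pathEdges (v j) (j * N + root T) (len j) s) p
  ... | inj₂ q = connector-edge<size (next σ) u w q
  ... | inj₁ q = pathEdges-< end (v j) (j * N + root T) (len j) s
                   (<-≤-trans (v<fresh₀ (suffix-< σ)) fresh₀≤end)
                   (<-≤-trans (copy<fresh₀ (suffix-< σ) root<size) fresh₀≤end)
                   (conns-size-≥ (suc j) f (s + pred (len j))) u w q
    where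
      end = proj₂ (conns (suc j) f (s + pred (len j)))
      fresh₀≤end = ≤-trans (suffix-fresh σ) (≤-trans (m≤m+n s _) (conns-size-≥ (suc j) f (s + pred (len j))))

  spineCut : ℕ → List Edge
  spineCut J with suc J <? d
  ... | yes _ = (v J , v (suc J)) ∷ []
  ... | no _  = []

  spineCut-∈ : ∀ {J} → suc J < d → (v J , v (suc J)) ∈ spineCut J
  spineCut-∈ {J} J+1<d with suc J <? d
  ... | yes _     = here refl
  ... | no J+1≮d = ⊥-elim (J+1≮d J+1<d)

  spineCut-∈⁻ : ∀ {J e} → e ∈ spineCut J → e ≡ (v J , v (suc J)) × suc J < d
  spineCut-∈⁻ {J} p with suc J <? d
  spineCut-∈⁻ (here refl) | yes J+1<d = refl , J+1<d

  |spineCut|≤1 : ∀ J → length (spineCut J) ≤ 1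
  |spineCut|≤1 J with suc J <? d
  ... | yes _ = ≤-refl
  ... | no _  = z≤n

  copy<spine : ∀ {c u i} → c < d → u < N → c * N + u < v i
  copy<spine {i = i} c<d u<N = ≤-trans (block-< c<d u<N) (m≤m+n (d * N) i)

  module Cut (J : ℕ) (J<d : J < d) (F : List Edge) (F⊆E : All (_∈ E) F) where

    F′ : List Edge
    F′ = map (shiftEdge (J * N)) F ++ spineCut J

    F′-∈⁻ : ∀ {e} → e ∈ F′ →
            (Σ Edge λ e₀ → e₀ ∈ F × e ≡ shiftEdge (J * N) e₀) ⊎ (e ≡ (v J , v (suc J)) × suc J < d)
    F′-∈⁻ p with ∈-++⁻ (map (shiftEdge (J * N)) F) p
    ... | inj₁ q = inj₁ (∈-map⁻ (shiftEdge (J * N)) q)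
    ... | inj₂ q = inj₂ (spineCut-∈⁻ q)

    inherit : ∀ e → e ∈ F → shiftEdge (J * N) e ∈ F′
    inherit e e∈F = ∈-++⁺ˡ (∈-map⁺ (shiftEdge (J * N)) e∈F)

    spine-cut : suc J < d → (v J , v (suc J)) ∈ F′
    spine-cut J+1<d = ∈-++⁺ʳ (map (shiftEdge (J * N)) F) (spineCut-∈ J+1<d)

    F′⊆E′ : All (_∈ E′) F′
    F′⊆E′ = All.tabulate λ p → ∈E′ (F′-∈⁻ p)
      where
        ∈E′ : ∀ {e} → (Σ Edge λ e₀ → e₀ ∈ F × e ≡ shiftEdge (J * N) e₀) ⊎ (e ≡ (v J , v (suc J)) × suc J < d) → e ∈ E′
        ∈E′ (inj₁ (e₀ , e₀∈F , refl)) = copyEdge∈ J<d (All.lookup F⊆E e₀∈F)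
        ∈E′ (inj₂ (refl , J+1<d))     = spineEdge∈ J+1<d

    F′<fresh₀ : ∀ a b → (a , b) ∈ F′ → a < fresh₀ × b < fresh₀
    F′<fresh₀ a b p with F′-∈⁻ p
    ... | inj₁ ((a₀ , b₀) , e₀∈F , refl) with (a₀<N , b₀<N) ← edge<size a₀ b₀ (All.lookup F⊆E e₀∈F) =
      copy<fresh₀ J<d a₀<N , copy<fresh₀ J<d b₀<N
    ... | inj₂ (refl , J+1<d) = v<fresh₀ J<d , v<fresh₀ J+1<d

    reflect : ∀ e → e ∈ E → shiftEdge (J * N) e ∈ F′ → e ∈ F
    reflect (a , b) e∈E p with F′-∈⁻ p
    ... | inj₁ (e₀ , e₀∈F , eq) = subst (_∈ F) (sym (shiftEdge-injective (J * N) eq)) e₀∈F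
    ... | inj₂ (eq , _)         = ⊥-elim (<⇒≢ (copy<spine J<d (proj₁ (edge<size a b e∈E))) (cong proj₁ eq))

    spine-open : ∀ i → i < J → (v i , v (suc i)) ∉ F′
    spine-open i i<J p with F′-∈⁻ p
    ... | inj₁ ((a₀ , b₀) , e₀∈F , eq) =
      <⇒≢ (copy<spine J<d (proj₁ (edge<size a₀ b₀ (All.lookup F⊆E e₀∈F)))) (sym (cong proj₁ eq))
    ... | inj₂ (eq , _) = <⇒≢ i<J (+-cancelˡ-≡ (d * N) i J (cong proj₁ eq))

    |F′|≤ : ∀ {h} → length F ≤ h → length F′ ≤ suc h
    |F′|≤ {h} |F|≤h = begin
      length F′                                          ≡⟨ length-++ (map (shiftEdge (J * N)) F) ⟩
      length (map (shiftEdge (J * N)) F) + length (spineCut J)  ≡⟨ cong (_+ length (spineCut J)) (length-map _ F) ⟩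
      length F + length (spineCut J)                     ≤⟨ +-mono-≤ |F|≤h (|spineCut|≤1 J) ⟩
      h + 1                                              ≡⟨ +-comm h 1 ⟩
      suc h                                              ∎
      where open ≤-Reasoning

  copy-walk : ∀ {J F F′ u k} → J < d → (∀ i → i < J → (v i , v (suc i)) ∉ F′) →
              (∀ a b → (a , b) ∈ F′ → a < fresh₀ × b < fresh₀) →
              (∀ e → e ∈ E → shiftEdge (J * N) e ∈ F′ → e ∈ F) →
              Walk E F (root T) u k → Walk E′ F′ (v 0) (J * N + u) (depthOf J + k)
  copy-walk {J} {F′ = F′} {u} {k} J<d spine-open F′<fresh₀ reflect w =
    subst (Walk E′ F′ (v 0) (J * N + u)) (sym (+-assoc J (len J) k))
      (spine-walk J J<d spine-open ++ʷ
        (connector-walk F′ F′<fresh₀ start z≤n J<d ++ʷ mapʷ (J * N +_) (copy-adj J<d reflect) w))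

  separation : ∀ {J c k} ψ u → J < d → k ≤ K → (c ≡ J → k + 2 ≤ ψ u) →
               depthOf J + k + 2 ≤ copyPotential J ψ c u
  separation {J} {c} {k} ψ u J<d k≤K same-copy with <-cmp c J
  ... | tri< c<J _ _ = begin
    depthOf J + k + 2          ≡⟨ +-assoc (depthOf J) k 2 ⟩
    depthOf J + (k + 2)        ≤⟨ +-monoʳ-≤ (depthOf J) (+-monoˡ-≤ 2 k≤K) ⟩
    depthOf J + (K + 2)        ≡⟨ cong (λ z → depthOf J + pred z) (+-suc K 2) ⟨
    depthOf J + pred (K + 3)   ≤⟨ copyDepth-gap d (K + 3) c J c<J (<⇒≤ J<d) 1≤K+3 ⟩
    depthOf c                  ≤⟨ m≤m+n (depthOf c) (level u) ⟩
    depthOf c + level u        ∎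
    where open ≤-Reasoning
  ... | tri≈ _ refl _ = begin
    depthOf J + k + 2          ≡⟨ +-assoc (depthOf J) k 2 ⟩
    depthOf J + (k + 2)        ≤⟨ +-monoʳ-≤ (depthOf J) (same-copy refl) ⟩
    depthOf J + ψ u            ∎
    where open ≤-Reasoning
  ... | tri> _ _ _ = begin
    depthOf J + k + 2          ≡⟨ +-assoc (depthOf J) k 2 ⟩
    depthOf J + (k + 2)        ≤⟨ +-mono-≤ (copyDepth-≤ d (K + 3) J 1≤K+3 (<⇒≤ J<d)) (+-monoˡ-≤ 2 k≤K) ⟩
    d * (K + 3) + (K + 2)      ≤⟨ +-monoʳ-≤ (d * (K + 3)) (≤-trans (n≤1+n (K + 2)) (≤-reflexive (sym (+-suc K 2)))) ⟩
    d * (K + 3) + (K + 3)      ≡⟨ +-comm (d * (K + 3)) (K + 3) ⟩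
    far                        ∎
    where open ≤-Reasoning

  certificate′ : ∀ {ℓ} → CopyLeaf ℓ → LeafCertificate (suc h) tree (potential d level) ℓ
  certificate′ (copyLeaf {J} {y} J<d y∈) = record
    { cut                 = F′
    ; cut⊆edges           = F′⊆E′
    ; |cut|≤h             = |F′|≤ |cut|≤h
    ; depth               = depthOf J + depth
    ; walk                = copy-walk J<d spine-open F′<fresh₀ reflect walk
    ; depth≤level         = ≤-trans (+-monoʳ-≤ (depthOf J) depth≤level)
                              (≤-reflexive (sym (trans (potential-copy d level J<d y<N) (copyPotential-< d level y J<d))))
    ; potential           = potential J ψ
    ; potential-root      = trans (potential-spine J ψ 1≤d) (gate-≤ {J} 0 z≤n)
    ; potential-lipschitz = potential-lipschitz J ψ cut F′ ψ-lipschitz ψ-root inherit spine-cut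
    ; depth≤potential     = ≤-trans (+-monoʳ-≤ (depthOf J) depth≤ψ)
                              (≤-reflexive (sym (trans (potential-copy J ψ J<d y<N) (copyPotential-≡ J ψ y))))
    ; potential-leaves    = leaves-far
    }
    where
      open LeafCertificate (certificate y y∈) renaming
        (potential to ψ; potential-root to ψ-root; potential-lipschitz to ψ-lipschitz;
         depth≤potential to depth≤ψ; potential-leaves to ψ-leaves)
      open Cut J J<d cut cut⊆edges
      y<N = leaf<size y y∈
      leaves-far : ∀ ℓ′ → ℓ′ ∈ copyLeaves → ℓ′ ≢ J * N + y → depthOf J + depth + 2 ≤ potential J ψ ℓ′
      leaves-far ℓ′ p ℓ′≢ with copyLeaf? p
      ... | copyLeaf {c} {y′} c<d y′∈ =
        subst (depthOf J + depth + 2 ≤_) (sym (potential-copy J ψ c<d (leaf<size y′ y′∈)))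
          (separation {c = c} ψ y′ J<d (≤-trans depth≤level (level≤K y<N))
            (λ { refl → ψ-leaves y′ y′∈ (λ y′≡y → ℓ′≢ (cong (J * N +_) y′≡y)) }))

  size-tree : ℕ
  size-tree = proj₂ connResult

  fresh₀≤size : fresh₀ ≤ size-tree
  fresh₀≤size = conns-size-≥ 0 d fresh₀

  within-maxHeight : ∀ {n m} → n ≤ d * (K + 3) → m ≤ maxHeight d h → n + m ≤ maxHeight d (suc h)
  within-maxHeight n≤ m≤ = +-mono-≤ (≤-trans n≤ (*-monoʳ-≤ d (+-monoˡ-≤ 3 K≤maxHeight))) m≤

  reachable′ : ∀ x → x < size-tree → Σ ℕ λ m → m ≤ maxHeight d (suc h) × Walk E′ [] (v 0) x m
  reachable′ x x<size with x <? d * N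
  ... | yes x<dN with (c , u , c<d , u<N , refl) ← block-decompose {N = N} {n = d} x<dN with (m , m≤ , w) ← reachable u u<N =
    depthOf c + m , within-maxHeight (copyDepth-≤ d (K + 3) c 1≤K+3 (<⇒≤ c<d)) m≤ ,
    copy-walk {F = []} {F′ = []} c<d (λ _ _ ()) (λ _ _ ()) (λ _ _ ()) w
  ... | no x≮dN with x <? fresh₀
  ...   | yes x<fresh₀ = i , ≤-trans (≤-reflexive (sym (+-identityʳ i))) (within-maxHeight i≤ z≤n) ,
                         subst (λ z → Walk E′ [] (v 0) z i) (m+[n∸m]≡n dN≤x) (spine-walk i i<d (λ _ _ ()))
    where
      dN≤x = ≮⇒≥ x≮dN
      i = x ∸ d * N
      i<d : i < d
      i<d = +-cancelˡ-< (d * N) i d (subst (_< fresh₀) (sym (m+[n∸m]≡n dN≤x)) x<fresh₀)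
      i≤ : i ≤ d * (K + 3)
      i≤ = ≤-trans (<⇒≤ i<d) (≤-trans (≤-reflexive (sym (*-identityʳ d))) (*-monoʳ-≤ d 1≤K+3))
  ...   | no x≮fresh₀ with (n , n≤ , w) ← connector-reach start (≮⇒≥ x≮fresh₀) x<size =
    n , ≤-trans (≤-reflexive (sym (+-identityʳ n))) (within-maxHeight n≤ z≤n) , w

  edge<size′ : ∀ u w → (u , w) ∈ E′ → u < size-tree × w < size-tree
  edge<size′ u w p with edgeView p
  ... | copyEdge {c} {u₀} {w₀} c<d e∈E with (u₀<N , w₀<N) ← edge<size u₀ w₀ e∈E =
    <-≤-trans (copy<fresh₀ c<d u₀<N) fresh₀≤size , <-≤-trans (copy<fresh₀ c<d w₀<N) fresh₀≤size
  ... | spineEdge i+1<d = <-≤-trans (v<fresh₀ (≤-trans (n≤1+n _) i+1<d)) fresh₀≤size ,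
                          <-≤-trans (v<fresh₀ i+1<d) fresh₀≤size
  ... | connectorEdge r = connector-edge<size start u w r

  leaf<size′ : ∀ {ℓ} → CopyLeaf ℓ → ℓ < size-tree
  leaf<size′ (copyLeaf c<d y∈) = <-≤-trans (copy<fresh₀ c<d (leaf<size _ y∈)) fresh₀≤size

  invariant′ : Invariant d (suc h) tree
  invariant′ = record
    { root<size       = <-≤-trans (v<fresh₀ 1≤d) fresh₀≤size
    ; leaf<size       = λ ℓ p → leaf<size′ (copyLeaf? p)
    ; edge<size       = edge<size′
    ; reachable       = reachable′
    ; level           = potential d level
    ; level-root      = trans (potential-spine d level 1≤d) (gate-≤ {d} 0 z≤n)
    ; level-lipschitz = potential-lipschitz d level [] [] level-lipschitz level-root (λ _ ())
                          (λ d+1<d → ⊥-elim (<⇒≱ d+1<d (n≤1+n d)))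
    ; size-bound      = ≤-trans (*-monoʳ-≤ 2 (conns-size-≤ 0 d fresh₀))
                          (size-step-bound d h N (K + 3) (connectorsLength 0 d) size-bound
                            (≤-trans (+-monoˡ-≤ 3 K≤maxHeight) (≤-reflexive (maxHeight+3≡ d h)))
                            (2*connectorsLength 0 d refl))
    ; leaf-count      = length-concat-applyUpTo (λ j → map (j * N +_) (leaves T)) d (d ^ h)
                          (λ j → trans (length-map _ (leaves T)) leaf-count)
    ; certificate     = λ ℓ p → certificate′ (copyLeaf? p)
    }

invariant : ∀ h d → 1 ≤ d → (T : Tree) → IsT d h T → Invariant d h T
invariant zero    d 1≤d _ base                          = invariant-T0 d 1≤d
invariant (suc h) d 1≤d _ (step {T = T} {k = K} 𝒯 height) =
  Extend.invariant′ d 1≤d h T K (invariant h d 1≤d T 𝒯) height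

lemma5 : (h d : ℕ) → 1 ≤ d → (T : Tree) → IsT d h T →
    (2 * size T ≤ 3 * ((h + 1) * (d + 1) ^ (h + 1))) ×
    (length (leaves T) ≡ d ^ h) ×
    (∀ ℓ → ℓ ∈ leaves T →
      Σ (List Edge) λ F → All (_∈ edges T) F × length F ≤ h ×
        Σ ℕ λ k → IsDist (edges T) F (root T) ℓ k ×
          (∀ ℓ′ → ℓ′ ∈ leaves T → ℓ′ ≢ ℓ → ∀ m →
            Walk (edges T) F (root T) ℓ′ m → k + 2 ≤ m))
lemma5 h d 1≤d T 𝒯 = size-bound , leaf-count , λ ℓ ℓ∈ →
  let open LeafCertificate (certificate ℓ ℓ∈)
      potential≤ : ∀ {x m} → Walk (edges T) cut (root T) x m → potential x ≤ m
      potential≤ = walk-length-≥-potential potential-lipschitz potential-root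
  in cut , cut⊆edges , |cut|≤h , depth ,
     (walk , λ m w → ≤-trans depth≤potential (potential≤ w)) ,
     λ ℓ′ ℓ′∈ ℓ′≢ℓ m w → ≤-trans (potential-leaves ℓ′ ℓ′∈ ℓ′≢ℓ) (potential≤ w)
  where open Invariant (invariant h d 1≤d T 𝒯)
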